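{- Let $\mathcal{C}$ be a category with finite products and weak equalisers in which every object is a choice object. If $\mathcal{C}$ is closed for pseudo-relations, then for every arrow $f\colon X\to I$ the pullback map $f^*\colon\mathrm{Presub}(I)\to\mathrm{Presub}(X)$ has a right adjoint.
   Context: Global elements $x\colon1\to X$ are written $x\in X$; for $a\colon A\to X$, $x\in_a$ means some $u\in A$ has $au=x$; $a$ is surjective if $x\in_a$ for every $x\in X$; an object is a choice object if every surjection onto it has a section. For $a\colon A\to X$, $b\colon B\to X$, $a\le b$ means $bh=a$ for some $h$; $\mathrm{Presub}(X)$ is the poset reflection of this preorder. $f^*\colon\mathrm{Presub}(I)\to\mathrm{Presub}(X)$ sends the class of $h\colon Z\to I$ to the class of the arrow $P\to X$ of a weak pullback (pullback without uniqueness) of $h$ along $f$. Closed for pseudo-relations: for $g\colon Y\to X$, $f\colon X\to I$, a family of pseudo-relations over $f,g$ is $h\colon J\to I$, $r\colon R\to J\times X\times Y$ with, for all elements, (a) $\langle j,x,y\rangle\in_r\Rightarrow gy=x$ and (b) $fx=hj\iff\exists y\in Y\,\langle j,x,y\rangle\in_r$. A pseudo-relation over $f,g$ with domain index $i\in I$ is $r\colon R\to X\times Y$ with $\langle x,y\rangle\in_r\Rightarrow gy=x$ and $fx=i\iff\exists y\,\langle x,y\rangle\in_r$. A full family over $f,g$ is a family $\phi\colon F\to I$, $\alpha\colon P\to F\times X\times Y$ over $f,g$ such that for every pseudo-relation $r$ over $f,g$ with domain index $i$ there is $c\in F$ with $\phi c=i$ and, for all $x,y$, $\langle c,x,y\rangle\in_\alpha\Rightarrow\langle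 x,y\rangle\in_r$. The category is closed for pseudo-relations if every composable pair has a full family over it. -}

module Defs where

open import Level using (Level; _⊔_; suc)
open import Data.Product using (Σ; ∃; ∃-syntax; _×_; _,_; proj₁; proj₂)
open import Relation.Binary.Structures using (IsEquivalence)

record Category (o ℓ e : Level) : Set (suc (o ⊔ ℓ ⊔ e)) where
  infix  4 _≈_
  infixr 9 _∘_
  field
    Obj   : Set o
    Hom   : Obj → Obj → Set ℓ
    _≈_   : ∀ {A B} → Hom A B → Hom A B → Set e
    id    : ∀ {A} → Hom A A
    _∘_   : ∀ {A B C} → Hom B C → Hom A B → Hom A C
    ≈-equiv  : ∀ {A B} → IsEquivalence (_≈_ {A} {B})
    ∘-resp-≈ : ∀ {A B C} {f f' : Hom B C} {g g' : Hom A B} →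
               f ≈ f' → g ≈ g' → f ∘ g ≈ f' ∘ g'
    assoc    : ∀ {A B C D} {f : Hom C D} {g : Hom B C} {h : Hom A B} →
               (f ∘ g) ∘ h ≈ f ∘ (g ∘ h)
    identityˡ : ∀ {A B} {f : Hom A B} → id ∘ f ≈ f
    identityʳ : ∀ {A B} {f : Hom A B} → f ∘ id ≈ f

module _ {o ℓ e : Level} (𝒞 : Category o ℓ e) where
  open Category 𝒞

  record FiniteProducts : Set (o ⊔ ℓ ⊔ e) where
    infixr 7 _⊗_
    field
      ⊤       : Obj
      !       : ∀ {A} → Hom A ⊤
      !-unique : ∀ {A} (h : Hom A ⊤) → h ≈ !
      _⊗_     : Obj → Obj → Obj
      π₁      : ∀ {A B} → Hom (A ⊗ B) A
      π₂      : ∀ {A B} → Hom (A ⊗ B) B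
      ⟨_,_⟩   : ∀ {A B C} → Hom C A → Hom C B → Hom C (A ⊗ B)
      π₁-⟨⟩   : ∀ {A B C} {f : Hom C A} {g : Hom C B} → π₁ ∘ ⟨ f , g ⟩ ≈ f
      π₂-⟨⟩   : ∀ {A B C} {f : Hom C A} {g : Hom C B} → π₂ ∘ ⟨ f , g ⟩ ≈ g
      ⟨⟩-unique : ∀ {A B C} {f : Hom C A} {g : Hom C B} (h : Hom C (A ⊗ B)) →
                  π₁ ∘ h ≈ f → π₂ ∘ h ≈ g → h ≈ ⟨ f , g ⟩

  record WeakEqualiser {A B : Obj} (f g : Hom A B) : Set (o ⊔ ℓ ⊔ e) where
    field
      E    : Obj
      arr  : Hom E A
      equ  : f ∘ arr ≈ g ∘ arr
      fact : ∀ {Z} (z : Hom Z A) → f ∘ z ≈ g ∘ z → ∃[ u ] (arr ∘ u ≈ z)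

  WeakEqualisers : Set (o ⊔ ℓ ⊔ e)
  WeakEqualisers = ∀ {A B} (f g : Hom A B) → WeakEqualiser f g

module Elements {o ℓ e : Level} (𝒞 : Category o ℓ e) (P : FiniteProducts 𝒞) where
  open Category 𝒞
  open FiniteProducts P

  El : Obj → Set ℓ
  El X = Hom ⊤ X

  _∈[_] : ∀ {A X} → El X → Hom A X → Set (ℓ ⊔ e)
  _∈[_] {A} x a = ∃[ u ] (a ∘ u ≈ x)

  Surjective : ∀ {A X} → Hom A X → Set (ℓ ⊔ e)
  Surjective {X = X} a = ∀ (x : El X) → x ∈[ a ]

  ChoiceObject : Obj → Set (o ⊔ ℓ ⊔ e)
  ChoiceObject X = ∀ {A} (a : Hom A X) → Surjective a → ∃[ s ] (a ∘ s ≈ id)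

  ⟪_,_,_⟫ : ∀ {J X Y} → El J → El X → El Y → El (J ⊗ (X ⊗ Y))
  ⟪ j , x , y ⟫ = ⟨ j , ⟨ x , y ⟩ ⟩

  _⇔_ : ∀ {a b} → Set a → Set b → Set (a ⊔ b)
  A ⇔ B = (A → B) × (B → A)

  record IsFamily {X Y I J R : Obj} (g : Hom Y X) (f : Hom X I)
                  (h : Hom J I) (r : Hom R (J ⊗ (X ⊗ Y))) : Set (ℓ ⊔ e) where
    field
      fam-a : ∀ (j : El J) (x : El X) (y : El Y) → ⟪ j , x , y ⟫ ∈[ r ] → g ∘ y ≈ x
      fam-b : ∀ (j : El J) (x : El X) → (f ∘ x ≈ h ∘ j) ⇔ (∃[ y ] (⟪ j , x , y ⟫ ∈[ r ]))

  record IsPseudoRelation {X Y I R : Obj} (g : Hom Y X) (f : Hom X I)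
                          (i : El I) (r : Hom R (X ⊗ Y)) : Set (ℓ ⊔ e) where
    field
      pr-a : ∀ (x : El X) (y : El Y) → ⟨ x , y ⟩ ∈[ r ] → g ∘ y ≈ x
      pr-b : ∀ (x : El X) → (f ∘ x ≈ i) ⇔ (∃[ y ] (⟨ x , y ⟩ ∈[ r ]))

  record FullFamily {X Y I : Obj} (g : Hom Y X) (f : Hom X I) : Set (o ⊔ ℓ ⊔ e) where
    field
      F      : Obj
      Pobj   : Obj
      φ      : Hom F I
      α      : Hom Pobj (F ⊗ (X ⊗ Y))
      family : IsFamily g f φ α
      full   : ∀ {R} (r : Hom R (X ⊗ Y)) (i : El I) → IsPseudoRelation g f i r →
               ∃[ c ] ((φ ∘ c ≈ i) ×
                       (∀ (x : El X) (y : El Y) → ⟪ c , x , y ⟫ ∈[ α ] → ⟨ x , y ⟩ ∈[ r ]))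

  ClosedForPseudoRelations : Set (o ⊔ ℓ ⊔ e)
  ClosedForPseudoRelations = ∀ {X Y I} (g : Hom Y X) (f : Hom X I) → FullFamily g f

  -- Presub(X): representatives are arrows into X, preordered by a ≤ b iff b h = a
  Presub : Obj → Set (o ⊔ ℓ)
  Presub X = Σ Obj (λ A → Hom A X)

  _≤ₚ_ : ∀ {X} → Presub X → Presub X → Set (ℓ ⊔ e)
  (A , a) ≤ₚ (B , b) = ∃[ h ] (b ∘ h ≈ a)

  -- f^* on representatives: the weak pullback of h along f built from the
  -- product X ⊗ Z and a weak equaliser of f ∘ π₁ and h ∘ π₂; its X-leg.
  pullbackPresub : WeakEqualisers 𝒞 → ∀ {X I} (f : Hom X I) → Presub I → Presub X
  pullbackPresub weq f (Z , h) =
    WeakEqualiser.E w , π₁ ∘ WeakEqualiser.arr w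
    where w = weq (f ∘ π₁) (h ∘ π₂)

  -- f^* : Presub(I) → Presub(X) has a right adjoint (a Galois connection on
  -- the preorders, which is the same as an adjunction of the poset reflections)
  HasRightAdjoint : WeakEqualisers 𝒞 → ∀ {X I} (f : Hom X I) → Set (o ⊔ ℓ ⊔ e)
  HasRightAdjoint weq {X} {I} f =
    Σ (Presub X → Presub I) λ ∀f → (∀ (h : Presub I) (a : Presub X) →
             (pullbackPresub weq f h ≤ₚ a) ⇔ (h ≤ₚ ∀f a))

module Submission where

-- The right adjoint of f* sends (A , a) to (F , φ), the index arrow of a
-- full family over the pair (a , f).  Both halves of the Galois connection
-- reduce to one principle, proved first: when Z is a choice object, an arrow
-- h : Z → I factors through f : X → I as soon as every global element of Z
-- does (the weak pullback of f and h is then surjective onto Z, and a section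
-- yields the factorisation).

open import Defs
open import Level using (Level)
open import Data.Product using (∃-syntax; _×_; _,_; proj₁)
open import Relation.Binary.Bundles using (Setoid)
import Relation.Binary.Reasoning.Setoid as SetoidReasoning

module _ {o ℓ e : Level} (𝒞 : Category o ℓ e) (P : FiniteProducts 𝒞) where
  open Category 𝒞
  open FiniteProducts P
  open Elements 𝒞 P

  homSetoid : Obj → Obj → Setoid ℓ e
  homSetoid A B = record
    { Carrier = Hom A B ; _≈_ = _≈_ ; isEquivalence = ≈-equiv }

  module HomReasoning {A B : Obj} = SetoidReasoning (homSetoid A B)
  open HomReasoning
  module HomEquiv {A B : Obj} = Setoid (homSetoid A B)
  open HomEquiv using () renaming (refl to ≈-refl; sym to ≈-sym; trans to ≈-trans)

  ∘-congˡ : ∀ {A B C} {f f' : Hom B C} {g : Hom A B} → f ≈ f' → f ∘ g ≈ f' ∘ g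
  ∘-congˡ p = ∘-resp-≈ p ≈-refl

  ∘-congʳ : ∀ {A B C} {f : Hom B C} {g g' : Hom A B} → g ≈ g' → f ∘ g ≈ f ∘ g'
  ∘-congʳ p = ∘-resp-≈ ≈-refl p

  ⊤-endo-id : (t : Hom ⊤ ⊤) → t ≈ id
  ⊤-endo-id t = ≈-trans (!-unique t) (≈-sym (!-unique id))

  ⟨⟩∘ : ∀ {A B C D} {f : Hom C A} {g : Hom C B} {t : Hom D C} →
        ⟨ f , g ⟩ ∘ t ≈ ⟨ f ∘ t , g ∘ t ⟩
  ⟨⟩∘ {f = f} {g} {t} = ⟨⟩-unique (⟨ f , g ⟩ ∘ t)
    (≈-trans (≈-sym assoc) (∘-congˡ π₁-⟨⟩))
    (≈-trans (≈-sym assoc) (∘-congˡ π₂-⟨⟩))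

  ⟨⟩-injective : ∀ {A B C} {x x' : Hom C A} {y y' : Hom C B} →
                 ⟨ x , y ⟩ ≈ ⟨ x' , y' ⟩ → (x ≈ x') × (y ≈ y')
  ⟨⟩-injective {x = x} {x'} {y} {y'} p =
      (begin x ≈⟨ ≈-sym π₁-⟨⟩ ⟩ π₁ ∘ ⟨ x , y ⟩ ≈⟨ ∘-congʳ p ⟩ π₁ ∘ ⟨ x' , y' ⟩ ≈⟨ π₁-⟨⟩ ⟩ x' ∎)
    , (begin y ≈⟨ ≈-sym π₂-⟨⟩ ⟩ π₂ ∘ ⟨ x , y ⟩ ≈⟨ ∘-congʳ p ⟩ π₂ ∘ ⟨ x' , y' ⟩ ≈⟨ π₂-⟨⟩ ⟩ y' ∎)

  module _ (weq : WeakEqualisers 𝒞) where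

    -- The weak pullback of f and h: the weak equaliser of f ∘ π₁ and h ∘ π₂
    -- on X ⊗ Z, with legs p₁ and p₂.  By definition f*(Z , h) = (Apex , p₁).
    module WeakPullback {X Z I : Obj} (f : Hom X I) (h : Hom Z I) where
      open WeakEqualiser (weq (f ∘ π₁) (h ∘ π₂)) renaming (E to Apex) public

      p₁ : Hom Apex X
      p₁ = π₁ ∘ arr

      p₂ : Hom Apex Z
      p₂ = π₂ ∘ arr

      commute : ∀ {T} (t : Hom T Apex) → f ∘ (p₁ ∘ t) ≈ h ∘ (p₂ ∘ t)
      commute t = begin
        f ∘ ((π₁ ∘ arr) ∘ t)   ≈⟨ ∘-congʳ assoc ⟩
        f ∘ (π₁ ∘ (arr ∘ t))   ≈⟨ ≈-sym assoc ⟩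
        (f ∘ π₁) ∘ (arr ∘ t)   ≈⟨ ≈-sym assoc ⟩
        ((f ∘ π₁) ∘ arr) ∘ t   ≈⟨ ∘-congˡ equ ⟩
        ((h ∘ π₂) ∘ arr) ∘ t   ≈⟨ assoc ⟩
        (h ∘ π₂) ∘ (arr ∘ t)   ≈⟨ assoc ⟩
        h ∘ (π₂ ∘ (arr ∘ t))   ≈⟨ ∘-congʳ (≈-sym assoc) ⟩
        h ∘ ((π₂ ∘ arr) ∘ t)   ∎

      universal : ∀ {T} (x : Hom T X) (z : Hom T Z) → f ∘ x ≈ h ∘ z →
                  ∃[ u ] ((p₁ ∘ u ≈ x) × (p₂ ∘ u ≈ z))
      universal x z fx≈hz with fact ⟨ x , z ⟩ cone
        where
        cone : (f ∘ π₁) ∘ ⟨ x , z ⟩ ≈ (h ∘ π₂) ∘ ⟨ x , z ⟩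
        cone = begin
          (f ∘ π₁) ∘ ⟨ x , z ⟩   ≈⟨ assoc ⟩
          f ∘ (π₁ ∘ ⟨ x , z ⟩)   ≈⟨ ∘-congʳ π₁-⟨⟩ ⟩
          f ∘ x                  ≈⟨ fx≈hz ⟩
          h ∘ z                  ≈⟨ ∘-congʳ (≈-sym π₂-⟨⟩) ⟩
          h ∘ (π₂ ∘ ⟨ x , z ⟩)   ≈⟨ ≈-sym assoc ⟩
          (h ∘ π₂) ∘ ⟨ x , z ⟩   ∎
      ... | u , arr∘u≈⟨x,z⟩ = u
        , ≈-trans assoc (≈-trans (∘-congʳ arr∘u≈⟨x,z⟩) π₁-⟨⟩)
        , ≈-trans assoc (≈-trans (∘-congʳ arr∘u≈⟨x,z⟩) π₂-⟨⟩)

    -- The leg p₂ of the weak pullback of f and h is then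
    -- surjective; a section s of it gives k = p₁ ∘ s with f ∘ k ≈ h.
    factor-by-choice : ∀ {X Z I} (f : Hom X I) (h : Hom Z I) → ChoiceObject Z →
                       (∀ (z : El Z) → ∃[ x ] (f ∘ x ≈ h ∘ z)) →
                       (Z , h) ≤ₚ (X , f)
    factor-by-choice f h choiceZ lift with choiceZ p₂ p₂-surjective
      where
      open WeakPullback f h
      p₂-surjective : Surjective p₂
      p₂-surjective z with lift z
      ... | x , fx≈hz with universal x z fx≈hz
      ... | u , _ , p₂u≈z = u , p₂u≈z
    ... | s , p₂s≈id = p₁ ∘ s , (begin
        f ∘ (p₁ ∘ s)   ≈⟨ commute s ⟩
        h ∘ (p₂ ∘ s)   ≈⟨ ∘-congʳ p₂s≈id ⟩
        h ∘ id         ≈⟨ identityʳ ⟩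
        h              ∎)
      where open WeakPullback f h

    -- Given m : f*(Z , h) → Y over X (that is, g ∘ m ≈ p₁) and z ∈ Z, the
    -- fibre of f*(Z , h) over z, mapped into X ⊗ Y by ⟨ p₁ , m ⟩, is a
    -- pseudo-relation over (g , f) with domain index h ∘ z.
    module Fibre {X Y Z I : Obj} (g : Hom Y X) (f : Hom X I) (h : Hom Z I)
                 (m : Hom (WeakPullback.Apex f h) Y)
                 (g∘m≈p₁ : g ∘ m ≈ WeakPullback.p₁ f h) (z : El Z) where
      open WeakPullback f h
      module Over = WeakPullback p₂ z

      relation : Hom Over.Apex (X ⊗ Y)
      relation = ⟨ p₁ , m ⟩ ∘ Over.p₁

      components : ∀ {x y} (v : El Over.Apex) → relation ∘ v ≈ ⟨ x , y ⟩ →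
                   (p₁ ∘ (Over.p₁ ∘ v) ≈ x) × (m ∘ (Over.p₁ ∘ v) ≈ y)
      components {x} {y} v rv≈⟨x,y⟩ = ⟨⟩-injective (begin
        ⟨ p₁ ∘ (Over.p₁ ∘ v) , m ∘ (Over.p₁ ∘ v) ⟩   ≈⟨ ≈-sym ⟨⟩∘ ⟩
        ⟨ p₁ , m ⟩ ∘ (Over.p₁ ∘ v)                   ≈⟨ ≈-sym assoc ⟩
        relation ∘ v                                 ≈⟨ rv≈⟨x,y⟩ ⟩
        ⟨ x , y ⟩                                    ∎)

      lies-over-z : ∀ (v : El Over.Apex) → p₂ ∘ (Over.p₁ ∘ v) ≈ z
      lies-over-z v = begin
        p₂ ∘ (Over.p₁ ∘ v)   ≈⟨ Over.commute v ⟩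
        z ∘ (Over.p₂ ∘ v)    ≈⟨ ∘-congʳ (⊤-endo-id _) ⟩
        z ∘ id               ≈⟨ identityʳ ⟩
        z                    ∎

      related⇒g-fst : ∀ x y → ⟨ x , y ⟩ ∈[ relation ] → g ∘ y ≈ x
      related⇒g-fst x y (v , rv≈⟨x,y⟩) =
        let (p₁v≈x , mv≈y) = components v rv≈⟨x,y⟩ in begin
        g ∘ y                      ≈⟨ ∘-congʳ (≈-sym mv≈y) ⟩
        g ∘ (m ∘ (Over.p₁ ∘ v))    ≈⟨ ≈-sym assoc ⟩
        (g ∘ m) ∘ (Over.p₁ ∘ v)    ≈⟨ ∘-congˡ g∘m≈p₁ ⟩
        p₁ ∘ (Over.p₁ ∘ v)         ≈⟨ p₁v≈x ⟩
        x                          ∎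

      related⇒in-domain : ∀ x → ∃[ y ] (⟨ x , y ⟩ ∈[ relation ]) → f ∘ x ≈ h ∘ z
      related⇒in-domain x (y , v , rv≈⟨x,y⟩) =
        let (p₁v≈x , _) = components v rv≈⟨x,y⟩ in begin
        f ∘ x                    ≈⟨ ∘-congʳ (≈-sym p₁v≈x) ⟩
        f ∘ (p₁ ∘ (Over.p₁ ∘ v)) ≈⟨ commute (Over.p₁ ∘ v) ⟩
        h ∘ (p₂ ∘ (Over.p₁ ∘ v)) ≈⟨ ∘-congʳ (lies-over-z v) ⟩
        h ∘ z                    ∎

      -- A point x over h z is the first leg of a point e of f*(Z , h) over z,
      -- which lies in the fibre; it is related to m ∘ e.
      in-domain⇒related : ∀ x → f ∘ x ≈ h ∘ z → ∃[ y ] (⟨ x , y ⟩ ∈[ relation ])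
      in-domain⇒related x fx≈hz with universal x z fx≈hz
      ... | e , p₁e≈x , p₂e≈z with Over.universal e id (≈-trans p₂e≈z (≈-sym identityʳ))
      ... | v , Over-p₁v≈e , _ = m ∘ e , v , (begin
        relation ∘ v                ≈⟨ assoc ⟩
        ⟨ p₁ , m ⟩ ∘ (Over.p₁ ∘ v)  ≈⟨ ∘-congʳ Over-p₁v≈e ⟩
        ⟨ p₁ , m ⟩ ∘ e              ≈⟨ ⟨⟩∘ ⟩
        ⟨ p₁ ∘ e , m ∘ e ⟩          ≈⟨ ⟨⟩-unique _ (≈-trans π₁-⟨⟩ p₁e≈x) π₂-⟨⟩ ⟩
        ⟨ x , m ∘ e ⟩               ∎)

      isPseudoRelation : IsPseudoRelation g f (h ∘ z) relation
      isPseudoRelation = record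
        { pr-a = related⇒g-fst
        ; pr-b = λ x → in-domain⇒related x , related⇒in-domain x }

    module _ (choice : ∀ X → ChoiceObject X) (closed : ClosedForPseudoRelations) where

      ∀[_] : ∀ {X I} → Hom X I → Presub X → Presub I
      ∀[ f ] (A , a) = FullFamily.F (closed a f) , FullFamily.φ (closed a f)

      -- f*(h) ≤ a implies h ≤ ∀_f a: fullness, applied to the fibre
      -- pseudo-relations, lifts every element of Z along φ.
      pullback≤⇒≤∀ : ∀ {X I} (f : Hom X I) (h : Presub I) (a : Presub X) →
                     pullbackPresub weq f h ≤ₚ a → h ≤ₚ ∀[ f ] a
      pullback≤⇒≤∀ f (Z , h) (A , a) (m , a∘m≈p₁) =
        factor-by-choice φ h (choice Z) lift
        where
        open FullFamily (closed a f)
        lift : ∀ (z : El Z) → ∃[ c ] (φ ∘ c ≈ h ∘ z)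
        lift z with full relation (h ∘ z) isPseudoRelation
          where open Fibre a f h m a∘m≈p₁ z
        ... | c , φc≈hz , _ = c , φc≈hz

      -- h ≤ ∀_f a implies f*(h) ≤ a: for each point e of f*(h), the family
      -- axiom (b) at index k (p₂ e) yields y related to p₁ e, and axiom (a)
      -- gives a ∘ y ≈ p₁ e.
      ≤∀⇒pullback≤ : ∀ {X I} (f : Hom X I) (h : Presub I) (a : Presub X) →
                     h ≤ₚ ∀[ f ] a → pullbackPresub weq f h ≤ₚ a
      ≤∀⇒pullback≤ f (Z , h) (A , a) (k , φ∘k≈h) =
        factor-by-choice a p₁ (choice Apex) lift
        where
        open FullFamily (closed a f)
        open IsFamily family
        open WeakPullback f h
        lift : ∀ (e : El Apex) → ∃[ y ] (a ∘ y ≈ p₁ ∘ e)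
        lift e with proj₁ (fam-b (k ∘ (p₂ ∘ e)) (p₁ ∘ e)) in-domain
          where
          in-domain : f ∘ (p₁ ∘ e) ≈ φ ∘ (k ∘ (p₂ ∘ e))
          in-domain = begin
            f ∘ (p₁ ∘ e)         ≈⟨ commute e ⟩
            h ∘ (p₂ ∘ e)         ≈⟨ ∘-congˡ (≈-sym φ∘k≈h) ⟩
            (φ ∘ k) ∘ (p₂ ∘ e)   ≈⟨ assoc ⟩
            φ ∘ (k ∘ (p₂ ∘ e))   ∎
        ... | y , related = y , fam-a _ _ y related

lemma4p6 : ∀ {o ℓ e : Level} (𝒞 : Category o ℓ e) (P : FiniteProducts 𝒞)
             (weq : WeakEqualisers 𝒞) →
             (∀ X → Elements.ChoiceObject 𝒞 P X) →
             Elements.ClosedForPseudoRelations 𝒞 P →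
             ∀ {X I} (f : Category.Hom 𝒞 X I) →
             Elements.HasRightAdjoint 𝒞 P weq f
lemma4p6 𝒞 P weq choice closed f =
    ∀[_] 𝒞 P weq choice closed f
  , λ h a → pullback≤⇒≤∀ 𝒞 P weq choice closed f h a
          , ≤∀⇒pullback≤ 𝒞 P weq choice closed f h a
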